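{- Let $(T,\mathcal{C},\mathcal{I},A)$ be a storyline instance. There exists a storyline solution $S=(\pi_1,\dots,\pi_\ell)$ with the minimum number of crossings such that for every $i\in\{2,\dots,\ell\}$ with $|\mathcal{I}(t_i)|=1$, say $\mathcal{I}(t_i)=\{I\}$, the following hold: (1) there exist sets $C_a,C_b$ with $\pi_i=\pi_i[C_a]\star\pi_i[\operatorname{char}(I)]\star\pi_i[C_b]$ (i.e. $C_a$ is the set of characters before and $C_b$ the set of characters after $\operatorname{char}(I)$ in $\pi_i$); (2) if $C_a\subseteq\operatorname{AC}(t_{i-1},t_i)$, then $\pi_i[C_a]=\pi_{i-1}[C_a]$; (3) if $\operatorname{char}(I)\subseteq\operatorname{AC}(t_{i-1},t_i)$, then $\pi_i[\operatorname{char}(I)]=\pi_{i-1}[\operatorname{char}(I)]$; (4) if $C_b\subseteq\operatorname{AC}(t_{i-1},t_i)$, then $\pi_i[C_b]=\pi_{i-1}[C_b]$.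
   Context: A storyline instance $(T,\mathcal{C},\mathcal{I},A)$ consists of totally ordered time steps $T=\{t_1,\dots,t_\ell\}$, a set of characters $\mathcal{C}$, a set of interactions $\mathcal{I}$, where each interaction $I$ has a time step $\operatorname{time}(I)\in T$ and a character set $\operatorname{char}(I)\subseteq\mathcal{C}$, and a map $A$ assigning to each character $c$ a set of consecutive time steps $A(c)=\{t_i,\dots,t_j\}$ (the steps at which $c$ is active). Let $\operatorname{AC}(t)=\{c: t\in A(c)\}$, $\operatorname{AC}(t_i,t_j)=\operatorname{AC}(t_i)\cap\dots\cap\operatorname{AC}(t_j)$, and $\mathcal{I}(t)=\{I:\operatorname{time}(I)=t\}$. It is assumed that $\operatorname{char}(I)\subseteq\operatorname{AC}(\operatorname{time}(I))$ for all $I$, that $\mathcal{I}(t)\neq\emptyset$ for every $t$, and that the character sets of the interactions at a common time step are pairwise disjoint. A storyline solution is a sequence $S=(\pi_1,\dots,\pi_\ell)$ where $\pi_i$ is a permutation (linear order) of $\operatorname{AC}(t_i)$ in which, for every $I\in\mathcal{I}(t_i)$, the characters of $\operatorname{char}(I)$ appear consecutively. For a permutation $\pi$ of $X$ and $Y\subseteq X$, $\pi[Y]$ denotes the restriction of $\pi$ to $Y$; $\pi\star\phi$ denotes concatenation of permutations of disjoint sets. For consecutive steps, $\operatorname{cr}(\pi_i,\pi_{i+1})$ is the number of pairs $\{c,c'\}\subseteq C=\operatorname{AC}(t_i)\cap\operatorname{AC}(t_{i+1})$ whose relative order differs in $\pi_i[C]$ and $\pi_{i+1}[C]$, and the number of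 crossings of $S$ is $\operatorname{cr}(S)=\sum_{i=1}^{\ell-1}\operatorname{cr}(\pi_i,\pi_{i+1})$. -}

module Defs where

open import Data.Nat using (ℕ; zero; suc; _≤_; _<_; _∸_; pred)
open import Data.Nat.Properties using (_≤?_)
open import Data.Fin using (Fin; _≟_)
open import Data.Bool using (Bool; true; false; _∧_; T)
open import Data.List using (List; []; _∷_; _++_; filter; length; map; upTo; allFin; cartesianProduct)
open import Data.Nat.ListAction using (sum)
open import Data.List.Relation.Unary.All using (All)
open import Data.List.Relation.Unary.Unique.Propositional using (Unique)
open import Data.List.Relation.Binary.Permutation.Propositional using (_↭_)
open import Data.List.Membership.Propositional using (_∈_; _∉_)
import Data.List.Membership.DecPropositional as DecMem
open import Data.Product using (Σ; ∃; ∃-syntax; _×_; _,_; proj₁; proj₂)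
open import Function.Bundles using (_⇔_)
open import Relation.Nullary using (Dec; yes; no; ¬_)
open import Relation.Nullary.Decidable using (_×-dec_; does; T?)
open import Relation.Binary.PropositionalEquality using (_≡_; _≢_)

-- Time steps t_1,…,t_ℓ are represented by 0,…,ℓ-1.
-- Characters are Fin n.  Character c is active exactly at the consecutive
-- time steps start c, …, end c.
record Instance : Set where
  field
    ℓ : ℕ
    n : ℕ
    start end : Fin n → ℕ
    start≤end : ∀ c → start c ≤ end c
    end<ℓ : ∀ c → end c < ℓ
    m : ℕ
    time : Fin m → ℕ
    char : Fin m → List (Fin n)
    time<ℓ : ∀ k → time k < ℓ
    char-set : ∀ k → Unique (char k)
    char-active : ∀ k c → c ∈ char k → start c ≤ time k × time k ≤ end c
    nonempty : ∀ t → t < ℓ → ∃[ k ] time k ≡ t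
    disjoint : ∀ k k' → k ≢ k' → time k ≡ time k' → ∀ c → c ∈ char k → c ∉ char k'

module _ (Π : Instance) where
  open Instance Π

  Active : Fin n → ℕ → Set
  Active c t = start c ≤ t × t ≤ end c

  active? : ∀ c t → Dec (Active c t)
  active? c t = (start c ≤? t) ×-dec (t ≤? end c)

  Active₂ : ℕ → ℕ → Fin n → Set
  Active₂ t t' c = Active c t × Active c t'

  active₂? : ∀ t t' c → Dec (Active₂ t t' c)
  active₂? t t' c = active? c t ×-dec active? c t'

  restrict : List (Fin n) → List (Fin n) → List (Fin n)
  restrict π Y = filter (λ c → DecMem._∈?_ _≟_ c Y) π

  before : List (Fin n) → Fin n → Fin n → Bool
  before [] c d = false
  before (x ∷ xs) c d with x ≟ c
  ... | yes _ = does (DecMem._∈?_ _≟_ d xs)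
  ... | no _ with x ≟ d
  ...   | yes _ = false
  ...   | no _ = before xs c d

  -- cr(π_t, π_{t+1}): number of unordered pairs {c,d} ⊆ C = AC(t) ∩ AC(t+1)
  -- whose relative order differs in π_t[C] and π_{t+1}[C].  Each such pair is
  -- counted exactly once, as the ordered pair (c,d) with c before d in π_t[C].
  cr : ℕ → List (Fin n) → List (Fin n) → ℕ
  cr t π π' = length (filter (λ p → T? (before πC (proj₁ p) (proj₂ p) ∧ before π'C (proj₂ p) (proj₁ p)))
                             (cartesianProduct (allFin n) (allFin n)))
    where
      πC  = filter (active₂? t (suc t)) π
      π'C = filter (active₂? t (suc t)) π'

  -- A sequence of linear orders, one per time step (values at t ≥ ℓ are irrelevant).
  Sequence : Set
  Sequence = ℕ → List (Fin n)

  IsSolution : Sequence → Set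
  IsSolution S = ∀ t → t < ℓ →
      Unique (S t)
    × (∀ c → (c ∈ S t) ⇔ Active c t)
    × (∀ k → time k ≡ t → ∃[ xs ] ∃[ ys ] ∃[ zs ] (S t ≡ xs ++ ys ++ zs × ys ↭ char k))

  crossings : Sequence → ℕ
  crossings S = sum (map (λ t → cr t (S t) (S (suc t))) (upTo (ℓ ∸ 1)))

  IsOptimal : Sequence → Set
  IsOptimal S = IsSolution S × (∀ S' → IsSolution S' → crossings S ≤ crossings S')

  -- The properties (1)–(4) at time step i (paper's t_i; i ≥ 1 here) for the
  -- unique interaction k at that time step.
  Normalised : Sequence → ℕ → Fin m → Set
  Normalised S i k = ∃[ Ca ] ∃[ Cb ]
      ( S i ≡ Ca ++ restrict (S i) (char k) ++ Cb
      × (All (Active₂ (pred i) i) Ca → restrict (S i) Ca ≡ restrict (S (pred i)) Ca)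
      × (All (Active₂ (pred i) i) (char k) → restrict (S i) (char k) ≡ restrict (S (pred i)) (char k))
      × (All (Active₂ (pred i) i) Cb → restrict (S i) Cb ≡ restrict (S (pred i)) Cb))

{-# OPTIONS --safe #-}

-- Start from an optimal solution; one exists because every π_t is a permutation of AC(t),
-- so there are only finitely many solutions to minimise over.  Then treat i = 1, …, ℓ-1
-- in turn: if I(t_i) = {I}, write π_i = π_i[C_a] ⋆ π_i[char(I)] ⋆ π_i[C_b] and replace
-- each of the three blocks that lies inside AC(t_{i-1}, t_i) by the order π_{i-1} induces
-- on it.  A pair from different blocks keeps its order.  A pair reordered inside a block
-- now agrees with π_{i-1}, so it no longer crosses between t_{i-1} and t_i, and it crosses
-- between t_i and t_{i+1} only if it crossed before in one of the two gaps: an inversion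
-- between π_{i-1} and π_{i+1} is one between π_{i-1} and π_i or between π_i and π_{i+1}.
-- So the solution stays optimal, and as only π_i changes, the steps before i stay normalised.

module Submission where

open import Defs
open import Data.Nat using (ℕ; _≤_; _<_)
open import Data.Fin using (Fin)
open import Data.Product using (∃-syntax; _×_)
open import Relation.Binary.PropositionalEquality using (_≡_)

open import Data.Bool using (Bool; true; false; _∧_)
open import Data.Empty using (⊥-elim)
open import Data.Fin using (_≟_)
import Data.Fin.Properties as Fin
open import Data.List using (List; []; _∷_; _++_; filter; length; concatMap; applyUpTo; allFin; cartesianProduct; cartesianProductWith)
open import Data.List.Extrema.Nat using (argmin; argmin-all; f[argmin]≤f[xs])
open import Data.List.Membership.Propositional using (_∈_; _∉_; find)
open import Data.List.Membership.Propositional.Properties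
  using (∈-allFin; ∈-concatMap⁻; ∈-++⁺ˡ; ∈-++⁺ʳ; ∈-++⁻; ∈-filter⁺; ∈-filter⁻; ∈-∃++; ∈-cartesianProductWith⁺; ∈-cartesianProductWith⁻)
open import Data.List.Membership.Propositional.Properties.WithK using (unique∧set⇒bag)
open import Data.List.Properties using (concatMap-++; ++-assoc; ++-identityʳ; map-upTo; filter-≐; filter-++; filter-all; filter-none)
open import Data.List.Relation.Binary.BagAndSetEquality using (∼bag⇒↭)
open import Data.List.Relation.Binary.Disjoint.Propositional using (Disjoint)
open import Data.List.Relation.Binary.Permutation.Propositional using (_↭_; ↭-refl; ↭-sym; ↭-trans; prep; ↭⇒↭ₛ)
open import Data.List.Relation.Binary.Permutation.Propositional.Properties
  using (shift; drop-mid; ↭-empty-inv; ↭-length; ∈-resp-↭; All-resp-↭; ++⁺)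
import Data.List.Relation.Binary.Permutation.Setoid.Properties as PermutationSetoid
open import Data.List.Relation.Unary.All using (All; []; _∷_; all?)
import Data.List.Relation.Unary.All as All
import Data.List.Relation.Unary.All.Properties as All
open import Data.List.Relation.Unary.AllPairs using ([]; _∷_)
open import Data.List.Relation.Unary.Any using (here; there)
import Data.List.Relation.Unary.Any as Any
open import Data.List.Relation.Unary.Unique.DecPropositional using (unique?)
open import Data.List.Relation.Unary.Unique.Propositional using (Unique)
open import Data.List.Relation.Unary.Unique.Propositional.Properties
  using (Unique[x∷xs]⇒x∉xs; filter⁺; allFin⁺) renaming (++⁺ to ++⁺ᵘ)
open import Data.Nat using (zero; suc; pred; _+_; _∸_; z≤n; s≤s)
open import Data.Nat.ListAction using (sum)
open import Data.Nat.Properties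
  using (≤-refl; ≤-reflexive; ≤-trans; ≤-<-trans; <⇒≤; <⇒≢; suc-injective; pred[n]≤n; m≤m+n; m≤n+m; m<n⇒m<1+n;
         m<1+n⇒m<n∨m≡n; +-assoc; +-identityʳ; +-mono-≤; +-monoˡ-≤; module ≤-Reasoning)
  renaming (_≟_ to _≟ℕ_)
open import Algebra.Properties.CommutativeSemigroup Data.Nat.Properties.+-commutativeSemigroup using (interchange)
open import Data.Product using (_,_; proj₁; proj₂; swap)
open import Data.Sum using (_⊎_; inj₁; inj₂; [_,_]′)
open import Function using (_∘_; id; case_of_)
open import Function.Bundles using (_⇔_; mk⇔; Equivalence)
open import Relation.Binary.Definitions using (DecidableEquality; Decidable)
open import Relation.Binary.PropositionalEquality
  using (_≢_; refl; sym; trans; cong; cong₂; subst; subst₂; setoid; module ≡-Reasoning)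
open import Relation.Nullary using (Dec; yes; no)
open import Relation.Nullary.Decidable using (does; map′; T?; ¬?; _×-dec_; _→-dec_; dec-true; dec-false; does-⇔)
open import Relation.Unary using () renaming (Decidable to Decidable₁)

bit : Bool → ℕ
bit true  = 1
bit false = 0

bit≤1 : ∀ b → bit b ≤ 1
bit≤1 true  = ≤-refl
bit≤1 false = z≤n

-- The triangle inequality for the inversions of one ordered pair (c, d): p, q, r say
-- whether P orders c before d, π orders d before c and π orders c before d; yc, yd say
-- whether c, d are active in the next gap, and b whether the next list orders d before c.
inversion-triangle : ∀ yc yd p q r b → (p ≡ true → r ≡ false → q ≡ true) →
                     bit ((yc ∧ (yd ∧ p)) ∧ b) ≤ bit (p ∧ q) + bit ((yc ∧ (yd ∧ r)) ∧ b)
inversion-triangle false _     _     _ _     _ _ = z≤n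
inversion-triangle true  false _     _ _     _ _ = z≤n
inversion-triangle true  true  false _ _     _ _ = z≤n
inversion-triangle true  true  true  q true  b _ = m≤n+m (bit b) (bit q)
inversion-triangle true  true  true  q false b h with refl ← h refl refl = ≤-trans (bit≤1 b) ≤-refl

count : {A : Set} → (A → Bool) → List A → ℕ
count f xs = length (filter (λ x → T? (f x)) xs)

count-∷ : ∀ {A : Set} (f : A → Bool) x xs → count f (x ∷ xs) ≡ bit (f x) + count f xs
count-∷ f x xs with f x
... | true  = refl
... | false = refl

count-≡0 : ∀ {A : Set} (f : A → Bool) → (∀ x → f x ≡ false) → ∀ xs → count f xs ≡ 0
count-≡0 f never []       = refl
count-≡0 f never (x ∷ xs) = trans (count-∷ f x xs) (cong₂ _+_ (cong bit (never x)) (count-≡0 f never xs))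

count-+-mono : ∀ {A : Set} (f g f′ g′ : A → Bool) →
               (∀ x → bit (f x) + bit (g x) ≤ bit (f′ x) + bit (g′ x)) →
               ∀ xs → count f xs + count g xs ≤ count f′ xs + count g′ xs
count-+-mono f g f′ g′ h []       = z≤n
count-+-mono f g f′ g′ h (x ∷ xs) = begin
  count f (x ∷ xs) + count g (x ∷ xs)
    ≡⟨ cong₂ _+_ (count-∷ f x xs) (count-∷ g x xs) ⟩
  (bit (f x) + count f xs) + (bit (g x) + count g xs)
    ≡⟨ interchange (bit (f x)) (count f xs) (bit (g x)) (count g xs) ⟩
  (bit (f x) + bit (g x)) + (count f xs + count g xs)
    ≤⟨ +-mono-≤ (h x) (count-+-mono f g f′ g′ h xs) ⟩
  (bit (f′ x) + bit (g′ x)) + (count f′ xs + count g′ xs)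
    ≡⟨ interchange (bit (f′ x)) (bit (g′ x)) (count f′ xs) (count g′ xs) ⟩
  (bit (f′ x) + count f′ xs) + (bit (g′ x) + count g′ xs)
    ≡⟨ cong₂ _+_ (count-∷ f′ x xs) (count-∷ g′ x xs) ⟨
  count f′ (x ∷ xs) + count g′ (x ∷ xs) ∎
  where open ≤-Reasoning

<∸1⇒1+< : ∀ {t} m → t < m ∸ 1 → suc t < m
<∸1⇒1+< (suc m) t<m = s≤s t<m

applyUpTo-cong : ∀ {A : Set} {f g : ℕ → A} M → (∀ t → t < M → f t ≡ g t) → applyUpTo f M ≡ applyUpTo g M
applyUpTo-cong zero    f≗g = refl
applyUpTo-cong (suc M) f≗g = cong₂ _∷_ (f≗g 0 (s≤s z≤n)) (applyUpTo-cong M (λ t t<M → f≗g (suc t) (s≤s t<M)))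

-- The hypothesis f j ≤ g j is what is left when suc j lies beyond the summation range.
sum-applyUpTo-local-≤ : ∀ {f g : ℕ → ℕ} M j → (∀ t → t ≢ j → t ≢ suc j → f t ≡ g t) →
                        f j ≤ g j → f j + f (suc j) ≤ g j + g (suc j) →
                        sum (applyUpTo f M) ≤ sum (applyUpTo g M)
sum-applyUpTo-local-≤ zero          j       f≗g h₁ h₂ = z≤n
sum-applyUpTo-local-≤ (suc zero)    zero    f≗g h₁ h₂ = +-monoˡ-≤ 0 h₁
sum-applyUpTo-local-≤ {f} {g} (suc (suc M)) zero f≗g h₁ h₂ = begin
  f 0 + (f 1 + rest f)  ≡⟨ +-assoc (f 0) (f 1) (rest f) ⟨
  (f 0 + f 1) + rest f  ≤⟨ +-mono-≤ h₂ (≤-reflexive (cong sum (applyUpTo-cong M (λ t _ → f≗g (2 + t) (λ ()) (λ ()))))) ⟩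
  (g 0 + g 1) + rest g  ≡⟨ +-assoc (g 0) (g 1) (rest g) ⟩
  g 0 + (g 1 + rest g)  ∎
  where
    open ≤-Reasoning
    rest : (ℕ → ℕ) → ℕ
    rest h = sum (applyUpTo (λ t → h (2 + t)) M)
sum-applyUpTo-local-≤ (suc M) (suc j) f≗g h₁ h₂ =
  +-mono-≤ (≤-reflexive (f≗g 0 (λ ()) (λ ())))
           (sum-applyUpTo-local-≤ M j (λ t t≢j t≢1+j → f≗g (suc t) (t≢j ∘ suc-injective) (t≢1+j ∘ suc-injective)) h₁ h₂)

module _ {A : Set} where

  _[_≔_] : (ℕ → A) → ℕ → A → ℕ → A
  (f [ i ≔ a ]) t with t ≟ℕ i
  ... | yes _ = a
  ... | no  _ = f t

  update-≡ : ∀ f i (a : A) → (f [ i ≔ a ]) i ≡ a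
  update-≡ f i a with i ≟ℕ i
  ... | yes _   = refl
  ... | no  i≢i = ⊥-elim (i≢i refl)

  update-≢ : ∀ f {i} (a : A) {t} → t ≢ i → (f [ i ≔ a ]) t ≡ f t
  update-≢ f {i} a {t} t≢i with t ≟ℕ i
  ... | yes t≡i = ⊥-elim (t≢i t≡i)
  ... | no  _   = refl

  choices : A → (ℕ → List A) → ℕ → List (ℕ → A)
  choices a C zero    = (λ _ → a) ∷ []
  choices a C (suc j) = cartesianProductWith (λ f x → f [ j ≔ x ]) (choices a C j) (C j)

  module _ {a : A} {C : ℕ → List A} where

    choices-sound : ∀ j {f} → f ∈ choices a C j → ∀ t → t < j → f t ∈ C t
    choices-sound (suc j) {f} f∈ t t<1+j
      with f₀ , x , f₀∈ , x∈ , refl ← ∈-cartesianProductWith⁻ (λ f x → f [ j ≔ x ]) (choices a C j) (C j) f∈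
      with m<1+n⇒m<n∨m≡n t<1+j
    ... | inj₂ refl = subst (_∈ C j) (sym (update-≡ f₀ j x)) x∈
    ... | inj₁ t<j  = subst (_∈ C t) (sym (update-≢ f₀ x (<⇒≢ t<j))) (choices-sound j f₀∈ t t<j)

    choices-complete : ∀ j (g : ℕ → A) → (∀ t → t < j → g t ∈ C t) →
                       ∃[ f ] (f ∈ choices a C j × ∀ t → t < j → f t ≡ g t)
    choices-complete zero    g g∈ = _ , here refl , λ _ ()
    choices-complete (suc j) g g∈ with f₀ , f₀∈ , f₀≗g ← choices-complete j g (λ t t<j → g∈ t (m<n⇒m<1+n t<j)) =
      f₀ [ j ≔ g j ] , ∈-cartesianProductWith⁺ (λ f x → f [ j ≔ x ]) f₀∈ (g∈ j ≤-refl) , agree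
      where
        agree : ∀ t → t < suc j → (f₀ [ j ≔ g j ]) t ≡ g t
        agree t t<1+j with m<1+n⇒m<n∨m≡n t<1+j
        ... | inj₂ refl = update-≡ f₀ j (g j)
        ... | inj₁ t<j  = trans (update-≢ f₀ (g j) (<⇒≢ t<j)) (f₀≗g t t<j)

  words : ℕ → List A → List (List A)
  words zero    xs = [] ∷ []
  words (suc k) xs = cartesianProductWith _∷_ xs (words k xs)

  ∈-words : ∀ {xs} ws → All (_∈ xs) ws → ws ∈ words (length ws) xs
  ∈-words []       []          = here refl
  ∈-words (w ∷ ws) (w∈ ∷ ws⊆) = ∈-cartesianProductWith⁺ _∷_ w∈ (∈-words ws ws⊆)

  ∃-split? : {P : List A → List A → Set} → (∀ ys zs → Dec (P ys zs)) →
             ∀ xs → Dec (∃[ ys ] ∃[ zs ] (xs ≡ ys ++ zs × P ys zs))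
  ∃-split? P? []       = map′ (λ p → [] , [] , refl , p) (λ { ([] , [] , refl , p) → p }) (P? [] [])
  ∃-split? P? (x ∷ xs) with P? [] (x ∷ xs) | ∃-split? (λ ys → P? (x ∷ ys)) xs
  ... | yes p | _                        = yes ([] , x ∷ xs , refl , p)
  ... | no _  | yes (ys , zs , refl , p) = yes (x ∷ ys , zs , refl , p)
  ... | no ¬p | no ¬q = no λ where
    ([] , _ , refl , p)      → ¬p p
    (_ ∷ ys , zs , refl , p) → ¬q (ys , zs , refl , p)

  Unique-resp-↭ : {xs ys : List A} → xs ↭ ys → Unique xs → Unique ys
  Unique-resp-↭ p = PermutationSetoid.Unique-resp-↭ (setoid A) (↭⇒↭ₛ p)

  unique-set⇒↭ : {xs ys : List A} → Unique xs → Unique ys → (∀ {x} → x ∈ xs ⇔ x ∈ ys) → xs ↭ ys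
  unique-set⇒↭ uxs uys xs≈ys = ∼bag⇒↭ (unique∧set⇒bag uxs uys xs≈ys)

  unique-++⁻ : ∀ u {r : List A} → Unique (u ++ r) → Unique u × Unique r × Disjoint u r
  unique-++⁻ []      ur = [] , ur , λ ()
  unique-++⁻ (x ∷ u) (x∉ ∷ ur) with uu , ur′ , u#r ← unique-++⁻ u ur =
    All.++⁻ˡ u x∉ ∷ uu , ur′ , λ where
      (here refl , x∈r) → All.lookup (All.++⁻ʳ u x∉) x∈r refl
      (there x∈u , x∈r) → u#r (x∈u , x∈r)

module _ {A : Set} (_≟_ : DecidableEquality A) where
  open import Data.List.Membership.DecPropositional _≟_ using (_∈?_)

  _↭?_ : Decidable (_↭_ {A = A})
  []       ↭? []       = yes ↭-refl
  []       ↭? (y ∷ ys) = no λ p → case ↭-empty-inv (↭-sym p) of λ ()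
  (x ∷ xs) ↭? ys with x ∈? ys
  ... | no x∉ys = no λ p → x∉ys (∈-resp-↭ p (here refl))
  ... | yes x∈ys with us , vs , refl ← ∈-∃++ x∈ys =
    map′ (λ p → ↭-trans (prep x p) (↭-sym (shift x us vs))) (drop-mid [] us) (xs ↭? (us ++ vs))

  block? : ∀ cs l → Dec (∃[ xs ] ∃[ ys ] ∃[ zs ] (l ≡ xs ++ ys ++ zs × ys ↭ cs))
  block? cs l = map′ (λ { (xs , _ , refl , ys , zs , refl , p) → xs , ys , zs , refl , p })
                     (λ { (xs , ys , zs , refl , p) → xs , ys ++ zs , refl , ys , zs , refl , p })
                     (∃-split? (λ _ → ∃-split? (λ ys _ → ys ↭? cs)) l)

_⇔?_ : {A B : Set} → Dec A → Dec B → Dec (A ⇔ B)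
a? ⇔? b? = map′ (λ (to , from) → mk⇔ to from) (λ e → Equivalence.to e , Equivalence.from e)
                ((a? →-dec b?) ×-dec (b? →-dec a?))

module _ (Π : Instance) where
  open Instance Π
  open import Data.List.Membership.DecPropositional (_≟_ {n}) using (_∈?_)

  -- Relative order in a list

  before-∉ˡ : ∀ {c} l d → c ∉ l → before Π l c d ≡ false
  before-∉ˡ []          d c∉ = refl
  before-∉ˡ {c} (x ∷ l) d c∉ with x ≟ c
  ... | yes refl = ⊥-elim (c∉ (here refl))
  ... | no _ with x ≟ d
  ...   | yes _ = refl
  ...   | no  _ = before-∉ˡ l d (c∉ ∘ there)

  before-∉ʳ : ∀ l c {d} → d ∉ l → before Π l c d ≡ false
  before-∉ʳ []          c d∉ = refl
  before-∉ʳ (x ∷ l) c {d} d∉ with x ≟ c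
  ... | yes _ = dec-false (d ∈? l) (d∉ ∘ there)
  ... | no _ with x ≟ d
  ...   | yes refl = ⊥-elim (d∉ (here refl))
  ...   | no  _    = before-∉ʳ l c (d∉ ∘ there)

  before-asym : ∀ {l} c d → Unique l → before Π l c d ≡ true → before Π l d c ≡ false
  before-asym {x ∷ l} c d u c≺d with x ≟ c
  before-asym {x ∷ l} c d u c≺d | yes refl with x ≟ d
  ... | yes refl = case trans (sym c≺d) (dec-false (x ∈? l) (Unique[x∷xs]⇒x∉xs u)) of λ ()
  ... | no _ with x ≟ x
  ...   | yes _  = refl
  ...   | no x≢x = ⊥-elim (x≢x refl)
  before-asym {x ∷ l} c d (_ ∷ ul) c≺d | no x≢c with x ≟ d
  ... | yes refl = case c≺d of λ ()
  ... | no _ with x ≟ c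
  ...   | yes x≡c = ⊥-elim (x≢c x≡c)
  ...   | no _    = before-asym c d ul c≺d

  before-∧-asym : ∀ {l} c d → Unique l → before Π l c d ∧ before Π l d c ≡ false
  before-∧-asym {l} c d ul with before Π l c d in c≺d
  ... | false = refl
  ... | true  = before-asym c d ul c≺d

  before-total : ∀ {l c d} → c ∈ l → d ∈ l → c ≢ d → before Π l c d ≡ true ⊎ before Π l d c ≡ true
  before-total {x ∷ l} {c} {d} c∈ d∈ c≢d with x ≟ c
  ... | yes refl = inj₁ (dec-true (d ∈? l) (Any.tail (c≢d ∘ sym) d∈))
  ... | no x≢c with x ≟ d
  ...   | yes refl = inj₂ (dec-true (c ∈? l) (Any.tail (x≢c ∘ sym) c∈))
  ...   | no x≢d with x ≟ c
  ...     | yes x≡c = ⊥-elim (x≢c x≡c)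
  ...     | no _    = before-total (Any.tail (x≢c ∘ sym) c∈) (Any.tail (x≢d ∘ sym) d∈) c≢d

  before-filter-inside : ∀ {X : Fin n → Set} (X? : Decidable₁ X) l {c d} → X c → X d →
                         before Π (filter X? l) c d ≡ before Π l c d
  before-filter-inside X? []      xc xd = refl
  before-filter-inside X? (x ∷ l) {c} {d} xc xd with X? x
  ... | yes _ with x ≟ c
  ...   | yes _ = does-⇔ (mk⇔ (proj₁ ∘ ∈-filter⁻ X?) (λ d∈ → ∈-filter⁺ X? d∈ xd)) (d ∈? filter X? l) (d ∈? l)
  ...   | no _ with x ≟ d
  ...     | yes _ = refl
  ...     | no _  = before-filter-inside X? l xc xd
  before-filter-inside X? (x ∷ l) {c} {d} xc xd | no ¬xx with x ≟ c
  ... | yes refl = ⊥-elim (¬xx xc)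
  ... | no _ with x ≟ d
  ...   | yes refl = ⊥-elim (¬xx xd)
  ...   | no _     = before-filter-inside X? l xc xd

  before-filter : ∀ {X : Fin n → Set} (X? : Decidable₁ X) l c d →
                  before Π (filter X? l) c d ≡ does (X? c) ∧ (does (X? d) ∧ before Π l c d)
  before-filter X? l c d with X? c | X? d
  ... | yes xc | yes xd = before-filter-inside X? l xc xd
  ... | yes _  | no ¬xd = before-∉ʳ (filter X? l) c (¬xd ∘ proj₂ ∘ ∈-filter⁻ X? {xs = l})
  ... | no ¬xc | _      = before-∉ˡ (filter X? l) d (¬xc ∘ proj₂ ∘ ∈-filter⁻ X? {xs = l})

  before-filter-cong : ∀ {X : Fin n → Set} (X? : Decidable₁ X) l l′ c d → before Π l′ c d ≡ before Π l c d →
                       before Π (filter X? l′) c d ≡ before Π (filter X? l) c d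
  before-filter-cong X? l l′ c d eq =
    trans (before-filter X? l′ c d) (trans (cong (λ b → does (X? c) ∧ (does (X? d) ∧ b)) eq) (sym (before-filter X? l c d)))

  before-++ˡ : ∀ u {r c d} → c ∈ u → d ∉ r → before Π (u ++ r) c d ≡ before Π u c d
  before-++ˡ (x ∷ u) {r} {c} {d} c∈ d∉r with x ≟ c
  ... | yes _ = does-⇔ (mk⇔ (λ d∈ → [ id , ⊥-elim ∘ d∉r ]′ (∈-++⁻ u d∈)) ∈-++⁺ˡ) (d ∈? u ++ r) (d ∈? u)
  ... | no x≢c with x ≟ d
  ...   | yes _ = refl
  ...   | no _  = before-++ˡ u (Any.tail (x≢c ∘ sym) c∈) d∉r

  before-++ʳ : ∀ u {r c d} → c ∉ u → d ∉ u → before Π (u ++ r) c d ≡ before Π r c d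
  before-++ʳ []      c∉ d∉ = refl
  before-++ʳ (x ∷ u) {r} {c} {d} c∉ d∉ with x ≟ c
  ... | yes refl = ⊥-elim (c∉ (here refl))
  ... | no _ with x ≟ d
  ...   | yes refl = ⊥-elim (d∉ (here refl))
  ...   | no _     = before-++ʳ u (c∉ ∘ there) (d∉ ∘ there)

  before-++-across : ∀ u {r c d} → c ∈ u → d ∉ u → d ∈ r → before Π (u ++ r) c d ≡ true
  before-++-across (x ∷ u) {r} {c} {d} c∈ d∉ d∈r with x ≟ c
  ... | yes _ = dec-true (d ∈? u ++ r) (∈-++⁺ʳ u d∈r)
  ... | no x≢c with x ≟ d
  ...   | yes refl = ⊥-elim (d∉ (here refl))
  ...   | no _     = before-++-across u (Any.tail (x≢c ∘ sym) c∈) (d∉ ∘ there) d∈r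

  order : List (Fin n) → Fin n → Fin n → Bool × Bool
  order l c d = before Π l c d , before Π l d c

  order-∉ˡ : ∀ {l c} d → c ∉ l → order l c d ≡ (false , false)
  order-∉ˡ {l} d c∉ = cong₂ _,_ (before-∉ˡ l d c∉) (before-∉ʳ l d c∉)

  order-∉ʳ : ∀ {l} c {d} → d ∉ l → order l c d ≡ (false , false)
  order-∉ʳ {l} c d∉ = cong₂ _,_ (before-∉ʳ l c d∉) (before-∉ˡ l c d∉)

  order-++ˡ : ∀ u {r c d} → Disjoint u r → c ∈ u → d ∈ u → order (u ++ r) c d ≡ order u c d
  order-++ˡ u u#r c∈ d∈ =
    cong₂ _,_ (before-++ˡ u c∈ (λ d∈r → u#r (d∈ , d∈r))) (before-++ˡ u d∈ (λ c∈r → u#r (c∈ , c∈r)))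

  order-++ʳ : ∀ u {r c d} → Disjoint u r → c ∈ r → d ∈ r → order (u ++ r) c d ≡ order r c d
  order-++ʳ u u#r c∈ d∈ =
    cong₂ _,_ (before-++ʳ u (λ c∈u → u#r (c∈u , c∈)) (λ d∈u → u#r (d∈u , d∈)))
              (before-++ʳ u (λ d∈u → u#r (d∈u , d∈)) (λ c∈u → u#r (c∈u , c∈)))

  order-++-across : ∀ u {r c d} → Unique (u ++ r) → c ∈ u → d ∈ r → order (u ++ r) c d ≡ (true , false)
  order-++-across u {r} {c} {d} ur c∈ d∈ = cong₂ _,_ c≺d (before-asym c d ur c≺d)
    where
      c≺d : before Π (u ++ r) c d ≡ true
      c≺d = before-++-across u c∈ (λ d∈u → proj₂ (proj₂ (unique-++⁻ u ur)) (d∈u , d∈)) d∈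

  restrict-cong : ∀ l {Y Y′} → Y ↭ Y′ → restrict Π l Y ≡ restrict Π l Y′
  restrict-cong l Y↭Y′ = filter-≐ (_∈? _) (_∈? _) (∈-resp-↭ Y↭Y′ , ∈-resp-↭ (↭-sym Y↭Y′)) l

  restrict-infix : ∀ {l} u b w → l ≡ u ++ b ++ w → Unique l → restrict Π l b ≡ b
  restrict-infix u b w refl ubw = begin
    filter (_∈? b) (u ++ b ++ w)                              ≡⟨ filter-++ (_∈? b) u (b ++ w) ⟩
    filter (_∈? b) u ++ filter (_∈? b) (b ++ w)               ≡⟨ cong (filter (_∈? b) u ++_) (filter-++ (_∈? b) b w) ⟩
    filter (_∈? b) u ++ filter (_∈? b) b ++ filter (_∈? b) w  ≡⟨ cong₂ (λ x z → x ++ filter (_∈? b) b ++ z) none-u none-w ⟩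
    filter (_∈? b) b ++ []                                    ≡⟨ cong (_++ []) (filter-all (_∈? b) (All.tabulate id)) ⟩
    b ++ []                                                   ≡⟨ ++-identityʳ b ⟩
    b                                                         ∎
    where
      open ≡-Reasoning
      u#bw = proj₂ (proj₂ (unique-++⁻ u ubw))
      b#w  = proj₂ (proj₂ (unique-++⁻ b (proj₁ (proj₂ (unique-++⁻ u ubw)))))
      none-u : filter (_∈? b) u ≡ []
      none-u = filter-none (_∈? b) (All.tabulate λ x∈u x∈b → u#bw (x∈u , ∈-++⁺ˡ x∈b))
      none-w : filter (_∈? b) w ≡ []
      none-w = filter-none (_∈? b) (All.tabulate λ x∈w x∈b → b#w (x∈b , x∈w))

  -- Realigning blocks to the previous permutation

  data Realigned (X : Fin n → Set) (P π π′ : List (Fin n)) (c d : Fin n) : Set where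
    kept    : order π′ c d ≡ order π c d → Realigned X P π π′ c d
    aligned : X c → X d → c ∈ π → d ∈ π → order π′ c d ≡ order P c d → Realigned X P π π′ c d

  realigned-resp : ∀ {X P π π′ ρ ρ′ c d} → order ρ c d ≡ order π c d → order ρ′ c d ≡ order π′ c d →
                   c ∈ ρ → d ∈ ρ → Realigned X P π π′ c d → Realigned X P ρ ρ′ c d
  realigned-resp ρ≡π ρ′≡π′ c∈ d∈ (kept π′≡π)               = kept (trans ρ′≡π′ (trans π′≡π (sym ρ≡π)))
  realigned-resp ρ≡π ρ′≡π′ c∈ d∈ (aligned xc xd _ _ π′≡P) = aligned xc xd c∈ d∈ (trans ρ′≡π′ π′≡P)

  realigned-++ : ∀ {X P} u r {u′ r′} → Unique (u ++ r) → u′ ↭ u → r′ ↭ r →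
                 (∀ {c d} → c ∈ u → d ∈ u → Realigned X P u u′ c d) →
                 (∀ {c d} → c ∈ r → d ∈ r → Realigned X P r r′ c d) →
                 ∀ {c d} → c ∈ u ++ r → d ∈ u ++ r → Realigned X P (u ++ r) (u′ ++ r′) c d
  realigned-++ {X} {P} u r {u′} {r′} ur u′↭u r′↭r Ru Rr {c} {d} c∈ d∈ = by-blocks (∈-++⁻ u c∈) (∈-++⁻ u d∈)
    where
      u#r : Disjoint u r
      u#r = proj₂ (proj₂ (unique-++⁻ u ur))
      u′r′ : Unique (u′ ++ r′)
      u′r′ = Unique-resp-↭ (↭-sym (++⁺ u′↭u r′↭r)) ur
      u′#r′ : Disjoint u′ r′
      u′#r′ = proj₂ (proj₂ (unique-++⁻ u′ u′r′))
      to-u′ : ∀ {x} → x ∈ u → x ∈ u′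
      to-u′ = ∈-resp-↭ (↭-sym u′↭u)
      to-r′ : ∀ {x} → x ∈ r → x ∈ r′
      to-r′ = ∈-resp-↭ (↭-sym r′↭r)
      by-blocks : c ∈ u ⊎ c ∈ r → d ∈ u ⊎ d ∈ r → Realigned X P (u ++ r) (u′ ++ r′) c d
      by-blocks (inj₁ c∈u) (inj₁ d∈u) =
        realigned-resp (order-++ˡ u u#r c∈u d∈u) (order-++ˡ u′ u′#r′ (to-u′ c∈u) (to-u′ d∈u)) c∈ d∈ (Ru c∈u d∈u)
      by-blocks (inj₂ c∈r) (inj₂ d∈r) =
        realigned-resp (order-++ʳ u u#r c∈r d∈r) (order-++ʳ u′ u′#r′ (to-r′ c∈r) (to-r′ d∈r)) c∈ d∈ (Rr c∈r d∈r)
      by-blocks (inj₁ c∈u) (inj₂ d∈r) =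
        kept (trans (order-++-across u′ u′r′ (to-u′ c∈u) (to-r′ d∈r)) (sym (order-++-across u ur c∈u d∈r)))
      by-blocks (inj₂ c∈r) (inj₁ d∈u) =
        kept (cong swap (trans (order-++-across u′ u′r′ (to-u′ d∈u) (to-r′ c∈r)) (sym (order-++-across u ur d∈u c∈r))))

  module Align {X : Fin n → Set} (X? : Decidable₁ X) {P : List (Fin n)} (uP : Unique P) (X⊆P : ∀ {c} → X c → c ∈ P) where

    align : List (Fin n) → List (Fin n)
    align b with all? X? b
    ... | yes _ = restrict Π P b
    ... | no  _ = b

    align-↭ : ∀ {b} → Unique b → align b ↭ b
    align-↭ {b} ub with all? X? b
    ... | no  _     = ↭-refl
    ... | yes all-X = unique-set⇒↭ (filter⁺ (_∈? b) uP) ub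
                        (mk⇔ (proj₂ ∘ ∈-filter⁻ (_∈? b) {xs = P}) (λ c∈b → ∈-filter⁺ (_∈? b) (X⊆P (All.lookup all-X c∈b)) c∈b))

    align-realigned : ∀ {b c d} → c ∈ b → d ∈ b → Realigned X P b (align b) c d
    align-realigned {b} {c} {d} c∈ d∈ with all? X? b
    ... | no  _     = kept refl
    ... | yes all-X = aligned (All.lookup all-X c∈) (All.lookup all-X d∈) c∈ d∈
                        (cong₂ _,_ (before-filter-inside (_∈? b) P c∈ d∈) (before-filter-inside (_∈? b) P d∈ c∈))

    align-all : ∀ {b} → All X b → align b ≡ restrict Π P b
    align-all {b} all-X with all? X? b
    ... | yes _    = refl
    ... | no ¬allX = ⊥-elim (¬allX all-X)

    restrict-aligned : ∀ {l} u b w {Y} → l ≡ u ++ align b ++ w → Unique l → Unique b → Y ↭ b → All X Y →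
                       restrict Π l Y ≡ restrict Π P Y
    restrict-aligned {l} u b w {Y} split ul ub Y↭b all-X = begin
      restrict Π l Y          ≡⟨ restrict-cong l (↭-trans Y↭b (↭-sym (align-↭ ub))) ⟩
      restrict Π l (align b)  ≡⟨ restrict-infix u (align b) w split ul ⟩
      align b                 ≡⟨ align-all (All-resp-↭ Y↭b all-X) ⟩
      restrict Π P b          ≡⟨ restrict-cong P (↭-sym Y↭b) ⟩
      restrict Π P Y          ∎
      where open ≡-Reasoning

    module Blocks (xs ys zs : List (Fin n)) (uπ : Unique (xs ++ ys ++ zs)) where

      π′ : List (Fin n)
      π′ = align xs ++ align ys ++ align zs

      unique-xs : Unique xs
      unique-xs = proj₁ (unique-++⁻ xs uπ)

      unique-ys++zs : Unique (ys ++ zs)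
      unique-ys++zs = proj₁ (proj₂ (unique-++⁻ xs uπ))

      unique-ys : Unique ys
      unique-ys = proj₁ (unique-++⁻ ys unique-ys++zs)

      unique-zs : Unique zs
      unique-zs = proj₁ (proj₂ (unique-++⁻ ys unique-ys++zs))

      π′↭π : π′ ↭ xs ++ ys ++ zs
      π′↭π = ++⁺ (align-↭ unique-xs) (++⁺ (align-↭ unique-ys) (align-↭ unique-zs))

      unique-π′ : Unique π′
      unique-π′ = Unique-resp-↭ (↭-sym π′↭π) uπ

      π′-realigned : ∀ c d → Realigned X P (xs ++ ys ++ zs) π′ c d
      π′-realigned c d with c ∈? xs ++ ys ++ zs | d ∈? xs ++ ys ++ zs
      ... | yes c∈ | yes d∈ =
        realigned-++ xs (ys ++ zs) uπ (align-↭ unique-xs) (++⁺ (align-↭ unique-ys) (align-↭ unique-zs)) align-realigned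
          (realigned-++ ys zs unique-ys++zs (align-↭ unique-ys) (align-↭ unique-zs) align-realigned align-realigned) c∈ d∈
      ... | no c∉  | _      = kept (trans (order-∉ˡ d (c∉ ∘ ∈-resp-↭ π′↭π)) (sym (order-∉ˡ d c∉)))
      ... | yes _  | no d∉  = kept (trans (order-∉ʳ c (d∉ ∘ ∈-resp-↭ π′↭π)) (sym (order-∉ʳ c d∉)))

      restrict-π′-middle : ∀ {Y} → Y ↭ ys → restrict Π π′ Y ≡ align ys
      restrict-π′-middle Y↭ys = trans (restrict-cong π′ (↭-trans Y↭ys (↭-sym (align-↭ unique-ys))))
                                      (restrict-infix (align xs) (align ys) (align zs) refl unique-π′)

      π′-left-normal : All X (align xs) → restrict Π π′ (align xs) ≡ restrict Π P (align xs)
      π′-left-normal = restrict-aligned [] xs (align ys ++ align zs) refl unique-π′ unique-xs (align-↭ unique-xs)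

      π′-middle-normal : ∀ {Y} → Y ↭ ys → All X Y → restrict Π π′ Y ≡ restrict Π P Y
      π′-middle-normal = restrict-aligned (align xs) ys (align zs) refl unique-π′ unique-ys

      π′-right-normal : All X (align zs) → restrict Π π′ (align zs) ≡ restrict Π P (align zs)
      π′-right-normal = restrict-aligned (align xs ++ align ys) zs [] π′≡ unique-π′ unique-zs (align-↭ unique-zs)
        where
          π′≡ : π′ ≡ (align xs ++ align ys) ++ align zs ++ []
          π′≡ = sym (trans (++-assoc (align xs) (align ys) (align zs ++ []))
                           (cong (λ z → align xs ++ align ys ++ z) (++-identityʳ (align zs))))

  -- Crossings

  -- Defs.cr Π t π π′ is, definitionally, count (inverted (active₂? Π t (suc t)) π π′) over all ordered pairs.
  inverted : {X : Fin n → Set} → Decidable₁ X → List (Fin n) → List (Fin n) → Fin n × Fin n → Bool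
  inverted X? l l′ (c , d) = before Π (filter X? l) c d ∧ before Π (filter X? l′) d c

  module _ {X Y : Fin n → Set} (X? : Decidable₁ X) (Y? : Decidable₁ Y) {P π π′ : List (Fin n)} (uP : Unique P) where

    aligned-no-inversion : ∀ {c d} → X c → X d → order π′ c d ≡ order P c d → inverted X? P π′ (c , d) ≡ false
    aligned-no-inversion {c} {d} xc xd π′≈P = begin
      before Π (filter X? P) c d ∧ before Π (filter X? π′) d c
        ≡⟨ cong₂ _∧_ (before-filter-inside X? P xc xd) (before-filter-inside X? π′ xd xc) ⟩
      before Π P c d ∧ before Π π′ d c
        ≡⟨ cong (before Π P c d ∧_) (cong proj₂ π′≈P) ⟩
      before Π P c d ∧ before Π P d c
        ≡⟨ before-∧-asym c d uP ⟩
      false ∎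
      where open ≡-Reasoning

    exchange-pair : ∀ N {c d} → Realigned X P π π′ c d →
                    bit (inverted X? P π′ (c , d)) + bit (inverted Y? π′ N (c , d))
                      ≤ bit (inverted X? P π (c , d)) + bit (inverted Y? π N (c , d))
    exchange-pair N {c} {d} (kept π′≈π) = ≤-reflexive (cong₂ _+_
      (cong (λ b → bit (before Π (filter X? P) c d ∧ b)) (before-filter-cong X? π π′ d c (cong proj₂ π′≈π)))
      (cong (λ b → bit (b ∧ before Π (filter Y? N) d c)) (before-filter-cong Y? π π′ c d (cong proj₁ π′≈π))))
    exchange-pair N {c} {d} (aligned xc xd c∈π d∈π π′≈P) = begin
      bit (inverted X? P π′ (c , d)) + bit (inverted Y? π′ N (c , d))
        ≡⟨ cong₂ (λ a b → bit a + bit (b ∧ B)) (aligned-no-inversion xc xd π′≈P)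
                 (trans (before-filter Y? π′ c d) (cong (λ b → yc ∧ (yd ∧ b)) (cong proj₁ π′≈P))) ⟩
      bit ((yc ∧ (yd ∧ before Π P c d)) ∧ B)
        ≤⟨ inversion-triangle yc yd (before Π P c d) (before Π π d c) (before Π π c d) B π-inverts ⟩
      bit (before Π P c d ∧ before Π π d c) + bit ((yc ∧ (yd ∧ before Π π c d)) ∧ B)
        ≡⟨ cong₂ (λ a b → bit a + bit (b ∧ B))
                 (sym (cong₂ _∧_ (before-filter-inside X? P xc xd) (before-filter-inside X? π xd xc)))
                 (sym (before-filter Y? π c d)) ⟩
      bit (inverted X? P π (c , d)) + bit (inverted Y? π N (c , d)) ∎
      where
        open ≤-Reasoning
        yc = does (Y? c)
        yd = does (Y? d)
        B  = before Π (filter Y? N) d c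
        π-inverts : before Π P c d ≡ true → before Π π c d ≡ false → before Π π d c ≡ true
        π-inverts c≺d c⊀d with before-total c∈π d∈π (λ { refl → case trans (sym c≺d) (before-asym c c uP c≺d) of λ () })
        ... | inj₁ c≺d′ = case trans (sym c≺d′) c⊀d of λ ()
        ... | inj₂ d≺c  = d≺c

  cr-exchange : ∀ j {P π π′} → Unique P → (∀ c d → Realigned (Active₂ Π j (suc j)) P π π′ c d) → ∀ N →
                cr Π j P π′ + cr Π (suc j) π′ N ≤ cr Π j P π + cr Π (suc j) π N
  cr-exchange j {P} {π} {π′} uP realigned N =
    count-+-mono (inverted X? P π′) (inverted Y? π′ N) (inverted X? P π) (inverted Y? π N)
                 (λ (c , d) → exchange-pair X? Y? uP N (realigned c d)) (cartesianProduct (allFin n) (allFin n))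
    where
      X? = active₂? Π j (suc j)
      Y? = active₂? Π (suc j) (suc (suc j))

  cr-self : ∀ t {π} → Unique π → cr Π t π π ≡ 0
  cr-self t {π} uπ = count-≡0 (inverted X? π π) (λ (c , d) → before-∧-asym c d (filter⁺ X? uπ))
                              (cartesianProduct (allFin n) (allFin n))
    where X? = active₂? Π t (suc t)

  cr-realigned-≤ : ∀ j {P π π′} → Unique P → Unique π → (∀ c d → Realigned (Active₂ Π j (suc j)) P π π′ c d) →
                   cr Π j P π′ ≤ cr Π j P π
  cr-realigned-≤ j {P} {π} {π′} uP uπ realigned = begin
    cr Π j P π′                      ≤⟨ m≤m+n _ _ ⟩
    cr Π j P π′ + cr Π (suc j) π′ π  ≤⟨ cr-exchange j uP realigned π ⟩
    cr Π j P π + cr Π (suc j) π π    ≡⟨ cong (cr Π j P π +_) (cr-self (suc j) uπ) ⟩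
    cr Π j P π + 0                   ≡⟨ +-identityʳ _ ⟩
    cr Π j P π                       ∎
    where open ≤-Reasoning

  crossingsAt : Sequence Π → ℕ → ℕ
  crossingsAt S t = cr Π t (S t) (S (suc t))

  crossings≡sum : ∀ S → crossings Π S ≡ sum (applyUpTo (crossingsAt S) (ℓ ∸ 1))
  crossings≡sum S = cong sum (map-upTo (crossingsAt S) (ℓ ∸ 1))

  crossings-cong : ∀ {S S′} → (∀ t → t < ℓ → S t ≡ S′ t) → crossings Π S ≡ crossings Π S′
  crossings-cong {S} {S′} S≗S′ = begin
    crossings Π S                             ≡⟨ crossings≡sum S ⟩
    sum (applyUpTo (crossingsAt S) (ℓ ∸ 1))   ≡⟨ cong sum (applyUpTo-cong (ℓ ∸ 1) same-crossings) ⟩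
    sum (applyUpTo (crossingsAt S′) (ℓ ∸ 1))  ≡⟨ crossings≡sum S′ ⟨
    crossings Π S′                            ∎
    where
      open ≡-Reasoning
      same-crossings : ∀ t → t < ℓ ∸ 1 → crossingsAt S t ≡ crossingsAt S′ t
      same-crossings t t<ℓ-1 = cong₂ (cr Π t) (S≗S′ t (<⇒≤ 1+t<ℓ)) (S≗S′ (suc t) 1+t<ℓ)
        where 1+t<ℓ = <∸1⇒1+< ℓ t<ℓ-1

  crossings-update : ∀ {S} j {π′} → IsSolution Π S → suc j < ℓ →
                     (∀ c d → Realigned (Active₂ Π j (suc j)) (S j) (S (suc j)) π′ c d) →
                     crossings Π (S [ suc j ≔ π′ ]) ≤ crossings Π S
  crossings-update {S} j {π′} sol i<ℓ realigned =
    subst₂ _≤_ (sym (crossings≡sum S′)) (sym (crossings≡sum S))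
      (sum-applyUpTo-local-≤ (ℓ ∸ 1) j
        (λ t t≢j t≢1+j → cong₂ (cr Π t) (update-≢ S π′ t≢1+j) (update-≢ S π′ (t≢j ∘ suc-injective)))
        (subst (_≤ crossingsAt S j) (sym (cong₂ (cr Π j) S′j≡P S′i≡π′))
               (cr-realigned-≤ j (proj₁ (sol j (<⇒≤ i<ℓ))) (proj₁ (sol (suc j) i<ℓ)) realigned))
        (subst (_≤ crossingsAt S j + crossingsAt S (suc j))
               (sym (cong₂ _+_ (cong₂ (cr Π j) S′j≡P S′i≡π′) (cong₂ (cr Π (suc j)) S′i≡π′ S′N≡N)))
               (cr-exchange j (proj₁ (sol j (<⇒≤ i<ℓ))) realigned (S (suc (suc j))))))
    where
      S′ = S [ suc j ≔ π′ ]
      S′j≡P : S′ j ≡ S j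
      S′j≡P = update-≢ S {suc j} π′ (<⇒≢ ≤-refl)
      S′i≡π′ : S′ (suc j) ≡ π′
      S′i≡π′ = update-≡ S (suc j) π′
      S′N≡N : S′ (suc (suc j)) ≡ S (suc (suc j))
      S′N≡N = update-≢ S {suc j} π′ (<⇒≢ ≤-refl ∘ sym)

  -- Normalising one time step

  ValidAt : ℕ → List (Fin n) → Set
  ValidAt t π = Unique π × (∀ c → (c ∈ π) ⇔ Active Π c t)
              × (∀ k → time k ≡ t → ∃[ xs ] ∃[ ys ] ∃[ zs ] (π ≡ xs ++ ys ++ zs × ys ↭ char k))

  solution-update : ∀ {S} i {π′} → IsSolution Π S → ValidAt i π′ → IsSolution Π (S [ i ≔ π′ ])
  solution-update i sol valid t t<ℓ with t ≟ℕ i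
  ... | yes refl = valid
  ... | no  _    = sol t t<ℓ

  normalise-at : ∀ {S} → IsSolution Π S → ∀ j → suc j < ℓ → ∀ k → time k ≡ suc j → (∀ k′ → time k′ ≡ suc j → k′ ≡ k) →
                 ∃[ S′ ] (IsSolution Π S′ × (∀ t → t ≢ suc j → S′ t ≡ S t)
                          × crossings Π S′ ≤ crossings Π S × Normalised Π S′ (suc j) k)
  normalise-at {S} sol j i<ℓ k tk k-only with xs , ys , zs , split , ys↭k ← proj₂ (proj₂ (sol (suc j) i<ℓ)) k tk =
    S [ suc j ≔ π′ ] , solution-update (suc j) sol π′-valid , (λ t → update-≢ S π′)
      , crossings-update j sol i<ℓ realigned , normalised
    where
      solⱼ = sol j (<⇒≤ i<ℓ)
      solᵢ = sol (suc j) i<ℓ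
      open Align (active₂? Π j (suc j)) (proj₁ solⱼ) (λ {c} active → Equivalence.from (proj₁ (proj₂ solⱼ) c) (proj₁ active))
      open Blocks xs ys zs (subst Unique split (proj₁ solᵢ))

      π′↭πᵢ : π′ ↭ S (suc j)
      π′↭πᵢ = subst (π′ ↭_) (sym split) π′↭π

      π′-valid : ValidAt (suc j) π′
      π′-valid = unique-π′
               , (λ c → mk⇔ (Equivalence.to (proj₁ (proj₂ solᵢ) c) ∘ ∈-resp-↭ π′↭πᵢ)
                            (∈-resp-↭ (↭-sym π′↭πᵢ) ∘ Equivalence.from (proj₁ (proj₂ solᵢ) c)))
               , λ k′ tk′ → subst (λ k″ → ∃[ as ] ∃[ bs ] ∃[ cs ] (π′ ≡ as ++ bs ++ cs × bs ↭ char k″)) (sym (k-only k′ tk′))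
                                  (align xs , align ys , align zs , refl , ↭-trans (align-↭ unique-ys) ys↭k)

      realigned : ∀ c d → Realigned (Active₂ Π j (suc j)) (S j) (S (suc j)) π′ c d
      realigned = subst (λ l → ∀ c d → Realigned (Active₂ Π j (suc j)) (S j) l π′ c d) (sym split) π′-realigned

      normalised : Normalised Π (S [ suc j ≔ π′ ]) (suc j) k
      normalised rewrite update-≡ S (suc j) π′ | update-≢ S {suc j} π′ {j} (<⇒≢ ≤-refl) =
          align xs , align zs , cong (λ Y → align xs ++ Y ++ align zs) (sym (restrict-π′-middle (↭-sym ys↭k)))
        , π′-left-normal , π′-middle-normal (↭-sym ys↭k) , π′-right-normal

  -- An optimal solution

  validAt? : ∀ t π → Dec (ValidAt t π)
  validAt? t π = unique? _≟_ π
          ×-dec Fin.all? (λ c → (c ∈? π) ⇔? active? Π c t)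
          ×-dec Fin.all? (λ k → (time k ≟ℕ t) →-dec block? _≟_ (char k) π)

  activeAt : ℕ → List (Fin n)
  activeAt t = filter (λ c → active? Π c t) (allFin n)

  -- A valid π is a permutation of the active characters, hence a word over them of the same length.
  candidates : ℕ → List (List (Fin n))
  candidates t = filter (validAt? t) (words (length (activeAt t)) (activeAt t))

  candidates-valid : ∀ {t π} → π ∈ candidates t → ValidAt t π
  candidates-valid {t} = proj₂ ∘ ∈-filter⁻ (validAt? t) {xs = words (length (activeAt t)) (activeAt t)}

  ∈-candidates : ∀ {t π} → ValidAt t π → π ∈ candidates t
  ∈-candidates {t} {π} valid@(uπ , π≈active , _) =
    ∈-filter⁺ (validAt? t) (subst (λ len → π ∈ words len (activeAt t)) (↭-length π↭active) (∈-words π (All.tabulate to-active))) valid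
    where
      to-active : ∀ {c} → c ∈ π → c ∈ activeAt t
      to-active {c} c∈π = ∈-filter⁺ (λ c → active? Π c t) (∈-allFin c) (Equivalence.to (π≈active c) c∈π)
      π↭active : π ↭ activeAt t
      π↭active = unique-set⇒↭ uπ (filter⁺ (λ c → active? Π c t) (allFin⁺ n))
        λ {c} → mk⇔ to-active (Equivalence.from (π≈active c) ∘ proj₂ ∘ ∈-filter⁻ (λ c → active? Π c t) {xs = allFin n})

  interactionsAt : ℕ → List (Fin m)
  interactionsAt t = filter (λ k → time k ≟ℕ t) (allFin m)

  grouped : ℕ → List (Fin n)
  grouped t = concatMap char (interactionsAt t)

  ungrouped : ℕ → List (Fin n)
  ungrouped t = filter (λ c → active? Π c t ×-dec ¬? (c ∈? grouped t)) (allFin n)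

  ∈-grouped : ∀ {t c} → c ∈ grouped t → ∃[ k ] (time k ≡ t × c ∈ char k)
  ∈-grouped {t} c∈ with k , k∈ , c∈k ← find (∈-concatMap⁻ char {xs = interactionsAt t} c∈) =
    k , proj₂ (∈-filter⁻ (λ k → time k ≟ℕ t) {xs = allFin m} k∈) , c∈k

  unique-concatMap-char : ∀ {t} ks → Unique ks → All (λ k → time k ≡ t) ks → Unique (concatMap char ks)
  unique-concatMap-char []       []           []         = []
  unique-concatMap-char (k ∷ ks) (k∉ks ∷ uks) (tk ∷ tks) =
    ++⁺ᵘ (char-set k) (unique-concatMap-char ks uks tks) λ {c} (c∈k , c∈ks) →
      let k′ , k′∈ks , c∈k′ = find (∈-concatMap⁻ char {xs = ks} c∈ks)
      in disjoint k k′ (All.lookup k∉ks k′∈ks) (trans tk (sym (All.lookup tks k′∈ks))) c c∈k c∈k′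

  initial : Sequence Π
  initial t = grouped t ++ ungrouped t

  initial-valid : ∀ t → ValidAt t (initial t)
  initial-valid t = unique-initial , (λ c → mk⇔ (to c) (from c)) , block
    where
      ungrouped? = λ c → active? Π c t ×-dec ¬? (c ∈? grouped t)
      unique-grouped : Unique (grouped t)
      unique-grouped = unique-concatMap-char (interactionsAt t) (filter⁺ (λ k → time k ≟ℕ t) (allFin⁺ m))
                         (All.tabulate (proj₂ ∘ ∈-filter⁻ (λ k → time k ≟ℕ t) {xs = allFin m}))
      unique-initial : Unique (initial t)
      unique-initial = ++⁺ᵘ unique-grouped (filter⁺ ungrouped? (allFin⁺ n))
        λ (c∈g , c∈u) → proj₂ (proj₂ (∈-filter⁻ ungrouped? {xs = allFin n} c∈u)) c∈g
      to : ∀ c → c ∈ initial t → Active Π c t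
      to c c∈ with ∈-++⁻ (grouped t) c∈
      ... | inj₁ c∈g = let k , tk , c∈k = ∈-grouped c∈g in subst (Active Π c) tk (char-active k c c∈k)
      ... | inj₂ c∈u = proj₁ (proj₂ (∈-filter⁻ ungrouped? {xs = allFin n} c∈u))
      from : ∀ c → Active Π c t → c ∈ initial t
      from c active with c ∈? grouped t
      ... | yes c∈g = ∈-++⁺ˡ c∈g
      ... | no  c∉g = ∈-++⁺ʳ (grouped t) (∈-filter⁺ ungrouped? (∈-allFin c) (active , c∉g))
      block : ∀ k → time k ≡ t → ∃[ xs ] ∃[ ys ] ∃[ zs ] (initial t ≡ xs ++ ys ++ zs × ys ↭ char k)
      block k tk with us , vs , split ← ∈-∃++ (∈-filter⁺ (λ k → time k ≟ℕ t) (∈-allFin k) tk) =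
        concatMap char us , char k , concatMap char vs ++ ungrouped t , initial≡ , ↭-refl
        where
          initial≡ : initial t ≡ concatMap char us ++ char k ++ concatMap char vs ++ ungrouped t
          initial≡ = begin
            concatMap char (interactionsAt t) ++ ungrouped t
              ≡⟨ cong (λ ks → concatMap char ks ++ ungrouped t) split ⟩
            concatMap char (us ++ k ∷ vs) ++ ungrouped t
              ≡⟨ cong (_++ ungrouped t) (concatMap-++ char us (k ∷ vs)) ⟩
            (concatMap char us ++ char k ++ concatMap char vs) ++ ungrouped t
              ≡⟨ ++-assoc (concatMap char us) _ (ungrouped t) ⟩
            concatMap char us ++ (char k ++ concatMap char vs) ++ ungrouped t
              ≡⟨ cong (concatMap char us ++_) (++-assoc (char k) (concatMap char vs) (ungrouped t)) ⟩
            concatMap char us ++ char k ++ concatMap char vs ++ ungrouped t ∎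
            where open ≡-Reasoning

  optimal : ∃[ S ] IsOptimal Π S
  optimal = S* , argmin-all (crossings Π) {P = IsSolution Π} (λ t _ → initial-valid t)
                   (All.tabulate λ S∈ t t<ℓ → candidates-valid (choices-sound ℓ S∈ t t<ℓ)) , minimal
    where
      sequences : List (Sequence Π)
      sequences = choices [] candidates ℓ
      S* : Sequence Π
      S* = argmin (crossings Π) initial sequences
      -- Matching on the witness with `with` would make Agda normalise crossings Π S*,
      -- that is, run argmin over all sequences.
      minimal : ∀ S′ → IsSolution Π S′ → crossings Π S* ≤ crossings Π S′
      minimal S′ sol′ = via (choices-complete ℓ S′ (λ t t<ℓ → ∈-candidates (sol′ t t<ℓ)))
        where
          via : ∃[ S ] (S ∈ sequences × ∀ t → t < ℓ → S t ≡ S′ t) → crossings Π S* ≤ crossings Π S′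
          via (S , S∈ , S≗S′) = ≤-trans (All.lookup (f[argmin]≤f[xs] initial sequences) S∈) (≤-reflexive (crossings-cong S≗S′))

  -- Normalising all time steps

  NormalisedAt : Sequence Π → ℕ → Set
  NormalisedAt S i = ∀ k → time k ≡ i → (∀ k′ → time k′ ≡ i → k′ ≡ k) → Normalised Π S i k

  NormalisedAt-cong : ∀ {S S′ i i′} → (∀ t → t ≢ i′ → S′ t ≡ S t) → i < i′ → NormalisedAt S i → NormalisedAt S′ i
  NormalisedAt-cong {i = i} S′≗S i<i′ normalised k tk only
    rewrite S′≗S i (<⇒≢ i<i′) | S′≗S (pred i) (<⇒≢ (≤-<-trans pred[n]≤n i<i′)) = normalised k tk only

  unique-interaction? : ∀ i → Dec (∃[ k ] (time k ≡ i × ∀ k′ → time k′ ≡ i → k′ ≡ k))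
  unique-interaction? i = Fin.any? λ k → (time k ≟ℕ i) ×-dec Fin.all? (λ k′ → (time k′ ≟ℕ i) →-dec (k′ ≟ k))

  NormalisedBelow : ℕ → Set
  NormalisedBelow M = ∃[ S ] (IsOptimal Π S × ∀ i → 1 ≤ i → i < M → NormalisedAt S i)

  normalise-next : ∀ j → suc j < ℓ → NormalisedBelow (suc j) → NormalisedBelow (suc (suc j))
  normalise-next j i<ℓ (S , opt@(sol , minimal) , done) with unique-interaction? (suc j)
  ... | no ¬unique = S , opt , extend
    where
      extend : ∀ i → 1 ≤ i → i < suc (suc j) → NormalisedAt S i
      extend i 1≤i i<2+j with m<1+n⇒m<n∨m≡n i<2+j
      ... | inj₁ i<1+j = done i 1≤i i<1+j
      ... | inj₂ refl  = λ k tk only → ⊥-elim (¬unique (k , tk , only))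
  ... | yes (k , tk , only) with S′ , sol′ , S′≗S , fewer , normalised ← normalise-at sol j i<ℓ k tk only =
    S′ , (sol′ , λ S″ sol″ → ≤-trans fewer (minimal S″ sol″)) , extend
    where
      extend : ∀ i → 1 ≤ i → i < suc (suc j) → NormalisedAt S′ i
      extend i 1≤i i<2+j with m<1+n⇒m<n∨m≡n i<2+j
      ... | inj₁ i<1+j = NormalisedAt-cong S′≗S i<1+j (done i 1≤i i<1+j)
      ... | inj₂ refl  = λ k′ tk′ only′ → subst (Normalised Π S′ (suc j)) (only′ k tk) normalised

  normalised-below : ∀ M → M ≤ ℓ → NormalisedBelow M
  normalised-below zero          _   = proj₁ optimal , proj₂ optimal , λ _ _ ()
  normalised-below (suc zero)    _   = proj₁ optimal , proj₂ optimal , λ { _ (s≤s _) (s≤s ()) }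
  normalised-below (suc (suc j)) i<ℓ = normalise-next j i<ℓ (normalised-below (suc j) (<⇒≤ i<ℓ))

theorem10 : (Π : Instance) → let open Instance Π in
    ∃[ S ] (IsOptimal Π S
      × (∀ i → 1 ≤ i → i < ℓ → ∀ (k : Fin m) → time k ≡ i
           → (∀ k' → time k' ≡ i → k' ≡ k)
           → Normalised Π S i k))
theorem10 Π = normalised-below Π (Instance.ℓ Π) ≤-refl
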